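{- Let $(F_1,F_1')$ and $(F_2,F_2')$ be pairs of neighboring runs of a string $T$, each pair consisting of two runs with the same period and equal Lyndon roots, such that $\mathrm{type}(F_1,F_1')\ne\mathrm{type}(F_2,F_2')$. Then $\mathrm{frag\text{ - }squares}(\mathbf{P}(F_1,F_1'))\cap\mathrm{frag\text{ - }squares}(\mathbf{P}(F_2,F_2'))=\emptyset$.
   Context: Strings are 0-indexed; $T[i\,..\,j]$ is a fragment and $S[i\,..\,j)=S[i\,..\,j-1]$. A positive integer $r\le|S|$ is a period of $S$ if $S[i]=S[i+r]$ for all valid $i$; $\mathrm{per}(S)$ is the smallest period; $S$ is periodic if $\mathrm{per}(S)\le|S|/2$. A run of $T$ is a periodic fragment $T[a\,..\,b]$ with $r=\mathrm{per}(T[a\,..\,b])$ such that ($a=0$ or $T[a-1]\ne T[a-1+r]$) and ($b=|T|-1$ or $T[b+1]\ne T[b+1-r]$). The Lyndon root of a periodic string $S$ is the lexicographically smallest rotation of $S[0\,..\,\mathrm{per}(S))$. Fragments $T[a\,..\,b]$, $T[a'\,..\,b']$ are neighboring if $[a-1\,..\,b+1]\cap[a'\,..\,b']\ne\emptyset$; then $F\cup F'=T[\min(a,a')\,..\,\max(b,b')]$ and $F\cap F'=T[\max(a,a')\,..\,\min(b,b')]$. A square $X^2$ is generated by a periodic fragment $V$ if $X^2$ is a fragment contained in $V$ with $\mathrm{per}(X^2)=\mathrm{per}(V)$; $\mathrm{frag\text{ - }squares}(V)$ is the set of these. $\mathrm{subper}(V)=\min\{\mathrm{per}(X):X^2\in\mathrm{frag\text{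 - }squares}(V)\}$; $V$ is subperiodic if $\mathrm{subper}(V)\le\mathrm{per}(V)/4$. For neighboring runs $F,F'$ with the same period $p$ and equal Lyndon roots, the pyramid $\mathbf{P}(F,F')$ is the set of subperiodic runs $R$ of $T$ with $\mathrm{subper}(R)=p$ such that $R\cap(F\cup F')$ is periodic with period $\mathrm{per}(R)$ (its layers), and $\mathrm{frag\text{ - }squares}(\mathbf{P}(F,F'))=\bigcup_{R\in\mathbf{P}(F,F')}\mathrm{frag\text{ - }squares}(R\cap(F\cup F'))$, considered as a set of strings. In a pair $(F,F')$, $F$ is the run starting earlier. The type of $(F,F')$ with common period $p$ is the triple $\mathrm{type}(F,F')=(|F\cap F'|,\ F[|F|-p\,..\,|F|),\ F'[0\,..\,p))$. -}

module Defs where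

open import Level using (0ℓ)
open import Data.Nat using (ℕ; zero; suc; _+_; _*_; _∸_; _≤_; _<_; _⊔_; _⊓_)
open import Data.List using (List; []; _∷_; length; take; drop; _++_)
open import Data.Maybe using (Maybe; just; nothing)
open import Data.Product using (Σ; _×_; _,_; proj₁; proj₂)
open import Data.Sum using (_⊎_)
open import Relation.Binary using (Rel)
open import Relation.Binary.PropositionalEquality using (_≡_; _≢_)

-- Strings are lists; positions are 0-indexed.
_‼_ : {A : Set} → List A → ℕ → Maybe A
[] ‼ _ = nothing
(x ∷ xs) ‼ zero = just x
(x ∷ xs) ‼ suc i = xs ‼ i

Period : {A : Set} → List A → ℕ → Set
Period S r = 1 ≤ r × r ≤ length S × (∀ i → i + r < length S → S ‼ i ≡ S ‼ (i + r))

Per : {A : Set} → List A → ℕ → Set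
Per S r = Period S r × (∀ r' → Period S r' → r ≤ r')

Periodic : {A : Set} → List A → Set
Periodic S = Σ ℕ λ r → Per S r × 2 * r ≤ length S

-- Fragment T[a..b] represented by its endpoints (a , b), both inclusive
Frag : Set
Frag = ℕ × ℕ

ValidFrag : {A : Set} → List A → Frag → Set
ValidFrag T (a , b) = a ≤ b × b < length T

str : {A : Set} → List A → Frag → List A
str T (a , b) = take (suc b ∸ a) (drop a T)

Run : {A : Set} → List A → Frag → Set
Run T (a , b) = ValidFrag T (a , b) ×
  (Σ ℕ λ r → Per (str T (a , b)) r × 2 * r ≤ length (str T (a , b)) ×
     (a ≡ 0 ⊎ T ‼ (a ∸ 1) ≢ T ‼ (a ∸ 1 + r)) ×
     (suc b ≡ length T ⊎ T ‼ suc b ≢ T ‼ (suc b ∸ r)))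

rot : {A : Set} → ℕ → List A → List A
rot k u = drop k u ++ take k u

data LexLeq {A : Set} (_<_ : Rel A 0ℓ) : List A → List A → Set where
  nil≤ : ∀ {ys} → LexLeq _<_ [] ys
  lt≤  : ∀ {x y xs ys} → x < y → LexLeq _<_ (x ∷ xs) (y ∷ ys)
  eq≤  : ∀ {x xs ys} → LexLeq _<_ xs ys → LexLeq _<_ (x ∷ xs) (x ∷ ys)

LyndonRoot : {A : Set} → Rel A 0ℓ → List A → List A → Set
LyndonRoot _≺_ S L = Σ ℕ λ p → Per S p × 2 * p ≤ length S ×
  (Σ ℕ λ k → k < p × L ≡ rot k (take p S)) ×
  (∀ j → j < p → LexLeq _≺_ L (rot j (take p S)))

-- neighboring fragments: [a-1..b+1] ∩ [a'..b'] ≠ ∅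
Neighboring : Frag → Frag → Set
Neighboring (a , b) (a' , b') = Σ ℕ λ i → a ≤ suc i × i ≤ suc b × a' ≤ i × i ≤ b'

_∪F_ : Frag → Frag → Frag
(a , b) ∪F (a' , b') = (a ⊓ a' , b ⊔ b')

_∩F_ : Frag → Frag → Frag
(a , b) ∩F (a' , b') = (a ⊔ a' , b ⊓ b')

RunPair : {A : Set} → Rel A 0ℓ → List A → Frag → Frag → ℕ → Set
RunPair _≺_ T F F' p = Run T F × Run T F' ×
  Per (str T F) p × Per (str T F') p ×
  (Σ _ λ L → LyndonRoot _≺_ (str T F) L × LyndonRoot _≺_ (str T F') L) ×
  Neighboring F F' × proj₁ F < proj₁ F'

type : {A : Set} → List A → Frag → Frag → ℕ → ℕ × List A × List A
type T F F' p =
  ( suc (proj₂ (F ∩F F')) ∸ proj₁ (F ∩F F')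
  , drop (length (str T F) ∸ p) (str T F)
  , take p (str T F') )

FragSq : {A : Set} → List A → Frag → List A → Set
FragSq T (a , b) X = Σ ℕ λ c → Σ ℕ λ d →
  a ≤ c × c ≤ d × d ≤ b × str T (c , d) ≡ X ++ X ×
  (Σ ℕ λ q → Per (str T (a , b)) q × Per (X ++ X) q)

Subper : {A : Set} → List A → Frag → ℕ → Set
Subper T V s = (Σ _ λ X → FragSq T V X × Per X s) ×
  (∀ X s' → FragSq T V X → Per X s' → s ≤ s')

InPyramid : {A : Set} → List A → Frag → Frag → ℕ → Frag → Set
InPyramid T F F' p R = Run T R × Subper T R p ×
  (Σ ℕ λ q → Per (str T R) q × 4 * p ≤ q ×
     proj₁ (R ∩F (F ∪F F')) ≤ proj₂ (R ∩F (F ∪F F')) ×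
     Per (str T (R ∩F (F ∪F F'))) q ×
     2 * q ≤ length (str T (R ∩F (F ∪F F'))))

PyrSq : {A : Set} → List A → Frag → Frag → ℕ → List A → Set
PyrSq T F F' p X = Σ Frag λ R → InPyramid T F F' p R × FragSq T (R ∩F (F ∪F F')) X

-- The square X² determines the type of every run pair whose pyramid generates it. Write
-- Y = X² = T[c .. d] with q = per(Y) ≥ 4p, and let L and α be the positions in Y where F ends and F'
-- starts. Y lies in neither run, since its period exceeds p; and inside the q-periodic Y a p-periodic
-- stretch that ends or starts at a p-mismatch is shorter than p + q, which yields 2p ≤ L and α + p ≤ |Y|.
-- Now p, L and α are read off Y alone: no prefix of Y of length between 2p and L has a period r < p
-- (a period r on r + p letters of F would spread over all of F), L is where the p-periodic prefix of
-- Y breaks, and α is where the p-periodic suffix of Y begins. Hence the type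
-- (L − α, Y[L−p .. L), Y[α .. α+p)) depends only on X.
module Submission where

open import Level using (0ℓ)
open import Algebra.Properties.CommutativeSemigroup using (xy∙z≈xz∙y)
open import Data.Empty using (⊥-elim)
open import Data.List using (List; []; _∷_; length; take; drop; _++_)
open import Data.List.Properties using (length-take; length-drop; length-++; take-take; take-[]; drop-drop)
open import Data.Nat
open import Data.Nat.Induction using (<-rec)
open import Data.Nat.Properties
open import Data.Nat.Tactic.RingSolver using (solve)
open import Data.Product using (∃; ∃₂; _×_; _,_; proj₁; proj₂)
open import Data.Sum using (inj₁; inj₂; [_,_]′)
open import Relation.Binary using (Rel; IsStrictTotalOrder)
open import Relation.Binary.PropositionalEquality
open import Relation.Nullary using (¬_; yes; no)

open import Defs

+-right-comm : ∀ m n o → m + n + o ≡ m + o + n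
+-right-comm = xy∙z≈xz∙y +-commutativeSemigroup

m+[n+n]≤o⇒n≤o∸m : ∀ m {n o} → m + (n + n) ≤ o → n ≤ o ∸ m
m+[n+n]≤o⇒n≤o∸m m {n} {o} m+2n≤o =
  m+n≤o⇒m≤o∸n n (≤-trans (+-monoˡ-≤ m (m≤m+n n n)) (subst (_≤ o) (+-comm m (n + n)) m+2n≤o))

4*n≤m+m⇒n+n≤m : ∀ n m → 4 * n ≤ m + m → n + n ≤ m
4*n≤m+m⇒n+n≤m n m 4n≤m+m = *-cancelˡ-≤ 2 (subst₂ _≤_ 4n≡2[n+n] m+m≡2m 4n≤m+m)
  where
  4n≡2[n+n] : 4 * n ≡ 2 * (n + n)
  4n≡2[n+n] = solve (n ∷ [])
  m+m≡2m : m + m ≡ 2 * m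
  m+m≡2m = solve (m ∷ [])

propagate-from-window : (P : ℕ → Set) {p lo u : ℕ} → 1 ≤ p →
  (∀ x → u ≤ x → x < u + p → P x) →
  (∀ x → u ≤ x → P x → P (x + p)) →
  (∀ x → lo ≤ x → x < u → P (x + p) → P x) →
  ∀ x → lo ≤ x → P x
propagate-from-window P {p} {lo} {u} 1≤p base up down x lo≤x = below u x lo≤x (m≤n+m u x)
  where
  above : ∀ x → u ≤ x → P x
  above = <-rec (λ x → u ≤ x → P x) step
    where
    step : ∀ x → (∀ {y} → y < x → u ≤ y → P y) → u ≤ x → P x
    step x rec u≤x with x <? u + p
    ... | yes x<u+p = base x u≤x x<u+p
    ... | no x≮u+p = subst P (m∸n+n≡m p≤x) (up y u≤y (rec y<x u≤y))
      where
      y = x ∸ p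
      u+p≤x : u + p ≤ x
      u+p≤x = ≮⇒≥ x≮u+p
      p≤x : p ≤ x
      p≤x = ≤-trans (m≤n+m p u) u+p≤x
      u≤y : u ≤ y
      u≤y = m+n≤o⇒m≤o∸n u u+p≤x
      y<x : y < x
      y<x = ∸-monoʳ-< 1≤p p≤x
  below : ∀ n x → lo ≤ x → u ≤ x + n → P x
  below zero x _ u≤x+0 = above x (subst (u ≤_) (+-identityʳ x) u≤x+0)
  below (suc n) x lo≤x u≤x+1+n with u ≤? x
  ... | yes u≤x = above x u≤x
  ... | no u≰x = down x lo≤x (≰⇒> u≰x) (below n (x + p) (≤-trans lo≤x (m≤m+n x p)) u≤x+p+n)
    where
    u≤x+p+n : u ≤ x + p + n
    u≤x+p+n = ≤-trans u≤x+1+n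
      (≤-trans (+-monoʳ-≤ x (+-monoˡ-≤ n 1≤p)) (≤-reflexive (sym (+-assoc x p n))))

module _ {A : Set} where

  ‼-take : ∀ n (xs : List A) {k} → k < n → take n xs ‼ k ≡ xs ‼ k
  ‼-take (suc n) []       _              = refl
  ‼-take (suc n) (x ∷ xs) {zero}  _      = refl
  ‼-take (suc n) (x ∷ xs) {suc k} (s≤s k<n) = ‼-take n xs k<n

  ‼-drop : ∀ m (xs : List A) k → drop m xs ‼ k ≡ xs ‼ (m + k)
  ‼-drop zero    xs       k = refl
  ‼-drop (suc m) []       k = refl
  ‼-drop (suc m) (x ∷ xs) k = ‼-drop m xs k

  ‼-++ˡ : ∀ (xs ys : List A) {k} → k < length xs → (xs ++ ys) ‼ k ≡ xs ‼ k
  ‼-++ˡ (x ∷ xs) ys {zero}  _         = refl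
  ‼-++ˡ (x ∷ xs) ys {suc k} (s≤s k<n) = ‼-++ˡ xs ys k<n

  ‼-++ʳ : ∀ (xs ys : List A) k → (xs ++ ys) ‼ (length xs + k) ≡ ys ‼ k
  ‼-++ʳ []       ys k = refl
  ‼-++ʳ (x ∷ xs) ys k = ‼-++ʳ xs ys k

  drop-take : ∀ m n (xs : List A) → drop m (take n xs) ≡ take (n ∸ m) (drop m xs)
  drop-take zero    n       xs       = refl
  drop-take (suc m) zero    xs       = refl
  drop-take (suc m) (suc n) []       = sym (take-[] (n ∸ m))
  drop-take (suc m) (suc n) (x ∷ xs) = drop-take m n xs

  -- The half-open fragment T[i .. j); str T (a , b) is slice T a (suc b) by definition.
  slice : List A → ℕ → ℕ → List A
  slice T i j = take (j ∸ i) (drop i T)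

  length-slice : ∀ (T : List A) i j → j ≤ length T → length (slice T i j) ≡ j ∸ i
  length-slice T i j j≤∣T∣ = begin
    length (slice T i j)             ≡⟨ length-take (j ∸ i) (drop i T) ⟩
    (j ∸ i) ⊓ length (drop i T)      ≡⟨ cong ((j ∸ i) ⊓_) (length-drop i T) ⟩
    (j ∸ i) ⊓ (length T ∸ i)         ≡⟨ m≤n⇒m⊓n≡m (∸-monoˡ-≤ i j≤∣T∣) ⟩
    j ∸ i                            ∎
    where open ≡-Reasoning

  ‼-slice : ∀ (T : List A) i j {k} → i + k < j → slice T i j ‼ k ≡ T ‼ (i + k)
  ‼-slice T i j {k} i+k<j =
    trans (‼-take (j ∸ i) (drop i T) k<j∸i) (‼-drop i T k)
    where
    k<j∸i : k < j ∸ i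
    k<j∸i = m+n≤o⇒m≤o∸n (suc k) (subst (_≤ j) (trans (sym (+-suc i k)) (+-comm i (suc k))) i+k<j)

  drop-slice : ∀ (T : List A) i j k → drop k (slice T i j) ≡ slice T (i + k) j
  drop-slice T i j k = begin
    drop k (take (j ∸ i) (drop i T))       ≡⟨ drop-take k (j ∸ i) (drop i T) ⟩
    take (j ∸ i ∸ k) (drop k (drop i T))   ≡⟨ cong₂ take (∸-+-assoc j i k) (drop-drop i k T) ⟩
    take (j ∸ (i + k)) (drop (i + k) T)    ∎
    where open ≡-Reasoning

  take-slice : ∀ (T : List A) {i j k} → i + k ≤ j → take k (slice T i j) ≡ slice T i (i + k)
  take-slice T {i} {j} {k} i+k≤j = begin
    take k (take (j ∸ i) (drop i T))  ≡⟨ take-take k (j ∸ i) (drop i T) ⟩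
    take (k ⊓ (j ∸ i)) (drop i T)     ≡⟨ cong (λ m → take m (drop i T)) (m≤n⇒m⊓n≡m k≤j∸i) ⟩
    take k (drop i T)                 ≡⟨ cong (λ m → take m (drop i T)) (sym (m+n∸m≡n i k)) ⟩
    take (i + k ∸ i) (drop i T)       ∎
    where
    open ≡-Reasoning
    k≤j∸i : k ≤ j ∸ i
    k≤j∸i = m+n≤o⇒m≤o∸n k (subst (_≤ j) (+-comm i k) i+k≤j)

  slice-slice : ∀ (T : List A) c e {i j} → i ≤ j → c + j ≤ e →
    slice (slice T c e) i j ≡ slice T (c + i) (c + j)
  slice-slice T c e {i} {j} i≤j c+j≤e = begin
    take (j ∸ i) (drop i (slice T c e))   ≡⟨ cong (take (j ∸ i)) (drop-slice T c e i) ⟩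
    take (j ∸ i) (slice T (c + i) e)      ≡⟨ take-slice T (≤-trans (≤-reflexive c+i+[j∸i]≡c+j) c+j≤e) ⟩
    slice T (c + i) (c + i + (j ∸ i))     ≡⟨ cong (slice T (c + i)) c+i+[j∸i]≡c+j ⟩
    slice T (c + i) (c + j)               ∎
    where
    open ≡-Reasoning
    c+i+[j∸i]≡c+j : c + i + (j ∸ i) ≡ c + j
    c+i+[j∸i]≡c+j = trans (+-assoc c i (j ∸ i)) (cong (c +_) (m+[n∸m]≡n i≤j))

  -- Local periods

  PeriodicOn : List A → ℕ → ℕ → ℕ → Set
  PeriodicOn S r i j = ∀ x → i ≤ x → x + r < j → S ‼ x ≡ S ‼ (x + r)

  Mismatch : List A → ℕ → ℕ → Set
  Mismatch S r k = S ‼ k ≢ S ‼ (k + r)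

  periodicOn-mono : ∀ (S : List A) {r i i' j j'} → i ≤ i' → j' ≤ j →
    PeriodicOn S r i j → PeriodicOn S r i' j'
  periodicOn-mono S i≤i' j'≤j per x i'≤x x+r<j' = per x (≤-trans i≤i' i'≤x) (<-≤-trans x+r<j' j'≤j)

  period⇒periodicOn : ∀ (S : List A) {r} → Period S r → PeriodicOn S r 0 (length S)
  period⇒periodicOn S (_ , _ , per) x _ = per x

  periodicOn⇒period : ∀ (S : List A) {r} → 1 ≤ r → r ≤ length S →
    PeriodicOn S r 0 (length S) → Period S r
  periodicOn⇒period S 1≤r r≤∣S∣ per = 1≤r , r≤∣S∣ , λ x → per x z≤n

  per-unique : ∀ (S : List A) {r r'} → Per S r → Per S r' → r ≡ r'
  per-unique S (period , least) (period' , least') = ≤-antisym (least _ period') (least' _ period)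

  per-square≤ : ∀ (X : List A) {q} → Per (X ++ X) q → q ≤ length X
  per-square≤ [] ((1≤q , q≤0 , _) , _) = ⊥-elim (<⇒≱ 1≤q q≤0)
  per-square≤ X@(_ ∷ _) (_ , least) = least (length X) (s≤s z≤n , ∣X∣≤∣XX∣ , halves-agree)
    where
    ∣X∣≤∣XX∣ : length X ≤ length (X ++ X)
    ∣X∣≤∣XX∣ = subst (length X ≤_) (sym (length-++ X)) (m≤m+n (length X) (length X))
    halves-agree : ∀ i → i + length X < length (X ++ X) → (X ++ X) ‼ i ≡ (X ++ X) ‼ (i + length X)
    halves-agree i i+∣X∣<∣XX∣ = begin
      (X ++ X) ‼ i                ≡⟨ ‼-++ˡ X X i<∣X∣ ⟩
      X ‼ i                       ≡⟨ sym (‼-++ʳ X X i) ⟩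
      (X ++ X) ‼ (length X + i)   ≡⟨ cong ((X ++ X) ‼_) (+-comm (length X) i) ⟩
      (X ++ X) ‼ (i + length X)   ∎
      where
      open ≡-Reasoning
      i<∣X∣ : i < length X
      i<∣X∣ = +-cancelʳ-< (length X) i (length X) (subst (i + length X <_) (length-++ X) i+∣X∣<∣XX∣)

  periodicOn-slice⁺ : ∀ (T : List A) {c e r i j} → c + j ≤ e →
    PeriodicOn T r (c + i) (c + j) → PeriodicOn (slice T c e) r i j
  periodicOn-slice⁺ T {c} {e} {r} {i} {j} c+j≤e per x i≤x x+r<j = begin
    slice T c e ‼ x          ≡⟨ ‼-slice T c e (in-slice (≤-<-trans (m≤m+n x r) x+r<j)) ⟩
    T ‼ (c + x)              ≡⟨ per (c + x) (+-monoʳ-≤ c i≤x)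
                                   (subst (_< c + j) (sym (+-assoc c x r)) (+-monoʳ-< c x+r<j)) ⟩
    T ‼ (c + x + r)          ≡⟨ cong (T ‼_) (+-assoc c x r) ⟩
    T ‼ (c + (x + r))        ≡⟨ sym (‼-slice T c e (in-slice x+r<j)) ⟩
    slice T c e ‼ (x + r)    ∎
    where
    open ≡-Reasoning
    in-slice : ∀ {y} → y < j → c + y < e
    in-slice y<j = <-≤-trans (+-monoʳ-< c y<j) c+j≤e

  periodicOn-slice⁻ : ∀ (T : List A) {c e r j} → c + j ≤ e →
    PeriodicOn (slice T c e) r 0 j → PeriodicOn T r c (c + j)
  periodicOn-slice⁻ T {c} {e} {r} {j} c+j≤e per x c≤x x+r<c+j = begin
    T ‼ x                    ≡⟨ cong (T ‼_) (sym c+y≡x) ⟩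
    T ‼ (c + y)              ≡⟨ sym (‼-slice T c e (in-slice (≤-<-trans (m≤m+n y r) y+r<j))) ⟩
    slice T c e ‼ y          ≡⟨ per y z≤n y+r<j ⟩
    slice T c e ‼ (y + r)    ≡⟨ ‼-slice T c e (in-slice y+r<j) ⟩
    T ‼ (c + (y + r))        ≡⟨ cong (T ‼_) c+[y+r]≡x+r ⟩
    T ‼ (x + r)              ∎
    where
    open ≡-Reasoning
    y = x ∸ c
    c+y≡x : c + y ≡ x
    c+y≡x = m+[n∸m]≡n c≤x
    c+[y+r]≡x+r : c + (y + r) ≡ x + r
    c+[y+r]≡x+r = trans (sym (+-assoc c y r)) (cong (_+ r) c+y≡x)
    y+r<j : y + r < j
    y+r<j = +-cancelˡ-< c (y + r) j (subst (_< c + j) (sym c+[y+r]≡x+r) x+r<c+j)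
    in-slice : ∀ {z} → z < j → c + z < e
    in-slice z<j = <-≤-trans (+-monoʳ-< c z<j) c+j≤e

  period-slice⇒periodicOn : ∀ (T : List A) {i j r} → i ≤ j → j ≤ length T →
    Period (slice T i j) r → PeriodicOn T r i j
  period-slice⇒periodicOn T {i} {j} i≤j j≤∣T∣ period =
    subst (PeriodicOn T _ i) (m+[n∸m]≡n i≤j)
      (periodicOn-slice⁻ T (≤-reflexive (m+[n∸m]≡n i≤j))
        (subst (PeriodicOn (slice T i j) _ 0) (length-slice T i j j≤∣T∣)
          (period⇒periodicOn (slice T i j) period)))

  periodicOn⇒period-slice : ∀ (T : List A) {i j r} → i ≤ j → j ≤ length T → 1 ≤ r → r ≤ j ∸ i →
    PeriodicOn T r i j → Period (slice T i j) r
  periodicOn⇒period-slice T {i} {j} i≤j j≤∣T∣ 1≤r r≤j∸i per =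
    periodicOn⇒period (slice T i j) 1≤r (subst (_ ≤_) (sym ∣slice∣≡) r≤j∸i)
      (subst (PeriodicOn (slice T i j) _ 0) (sym ∣slice∣≡)
        (periodicOn-slice⁺ T (≤-reflexive (m+[n∸m]≡n i≤j))
          (subst₂ (PeriodicOn T _) (sym (+-identityʳ i)) (sym (m+[n∸m]≡n i≤j)) per)))
    where
    ∣slice∣≡ : length (slice T i j) ≡ j ∸ i
    ∣slice∣≡ = length-slice T i j j≤∣T∣

  -- A window of length r + p meets every residue class mod p, and p-shifts carry the period r along.
  periodicOn-extend : ∀ (S : List A) {p r i j c M} → 1 ≤ p → PeriodicOn S p i j →
    i ≤ c → c + M ≤ j → r + p ≤ M → PeriodicOn S r c (c + M) → PeriodicOn S r i j
  periodicOn-extend S {p} {r} {i} {j} {c} {M} 1≤p per-p i≤c c+M≤j r+p≤M per-r y i≤y =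
    propagate-from-window P 1≤p base up down y i≤y
    where
    P : ℕ → Set
    P x = x + r < j → S ‼ x ≡ S ‼ (x + r)
    c+p+r≤c+M : c + p + r ≤ c + M
    c+p+r≤c+M = ≤-trans (≤-reflexive (trans (+-assoc c p r) (cong (c +_) (+-comm p r)))) (+-monoʳ-≤ c r+p≤M)
    x+p<j : ∀ x → x + p + r < j → x + p < j
    x+p<j x = ≤-<-trans (m≤m+n (x + p) r)
    shift-r : ∀ x → i ≤ x → x + p + r < j → S ‼ (x + r) ≡ S ‼ (x + p + r)
    shift-r x i≤x x+p+r<j = trans
      (per-p (x + r) (≤-trans i≤x (m≤m+n x r)) (subst (_< j) (+-right-comm x p r) x+p+r<j))
      (cong (S ‼_) (+-right-comm x r p))
    base : ∀ x → c ≤ x → x < c + p → P x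
    base x c≤x x<c+p _ = per-r x c≤x (<-≤-trans (+-monoˡ-< r x<c+p) c+p+r≤c+M)
    up : ∀ x → c ≤ x → P x → P (x + p)
    up x c≤x Px x+p+r<j = begin
      S ‼ (x + p)        ≡⟨ sym (per-p x i≤x (x+p<j x x+p+r<j)) ⟩
      S ‼ x              ≡⟨ Px (≤-<-trans (+-monoˡ-≤ r (m≤m+n x p)) x+p+r<j) ⟩
      S ‼ (x + r)        ≡⟨ shift-r x i≤x x+p+r<j ⟩
      S ‼ (x + p + r)    ∎
      where
      open ≡-Reasoning
      i≤x : i ≤ x
      i≤x = ≤-trans i≤c c≤x
    down : ∀ x → i ≤ x → x < c → P (x + p) → P x
    down x i≤x x<c Px+p _ = begin
      S ‼ x              ≡⟨ per-p x i≤x (x+p<j x x+p+r<j) ⟩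
      S ‼ (x + p)        ≡⟨ Px+p x+p+r<j ⟩
      S ‼ (x + p + r)    ≡⟨ sym (shift-r x i≤x x+p+r<j) ⟩
      S ‼ (x + r)        ∎
      where
      open ≡-Reasoning
      x+p+r<j : x + p + r < j
      x+p+r<j = <-≤-trans (+-monoˡ-< r (+-monoˡ-< p x<c)) (≤-trans c+p+r≤c+M c+M≤j)

  periodicOn-before-mismatch : ∀ (S : List A) {p q lo hi k} → 1 ≤ q → PeriodicOn S q lo hi →
    PeriodicOn S p lo (k + p) → k + p < hi → Mismatch S p k → k < lo + q
  periodicOn-before-mismatch S {p} {q} {lo} {hi} {k} 1≤q per-q per-p k+p<hi mismatch =
    ≰⇒> λ lo+q≤k → mismatch (agree lo+q≤k)
    where
    agree : lo + q ≤ k → S ‼ k ≡ S ‼ (k + p)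
    agree lo+q≤k = begin
      S ‼ k              ≡⟨ cong (S ‼_) (sym x+q≡k) ⟩
      S ‼ (x + q)        ≡⟨ sym (per-q x lo≤x (subst (_< hi) (sym x+q≡k) (≤-<-trans (m≤m+n k p) k+p<hi))) ⟩
      S ‼ x              ≡⟨ per-p x lo≤x (+-monoˡ-< p x<k) ⟩
      S ‼ (x + p)        ≡⟨ per-q (x + p) (≤-trans lo≤x (m≤m+n x p)) (subst (_< hi) (sym x+p+q≡k+p) k+p<hi) ⟩
      S ‼ (x + p + q)    ≡⟨ cong (S ‼_) x+p+q≡k+p ⟩
      S ‼ (k + p)        ∎
      where
      open ≡-Reasoning
      x = k ∸ q
      q≤k : q ≤ k
      q≤k = ≤-trans (m≤n+m q lo) lo+q≤k
      x+q≡k : x + q ≡ k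
      x+q≡k = m∸n+n≡m q≤k
      x+p+q≡k+p : x + p + q ≡ k + p
      x+p+q≡k+p = trans (+-right-comm x p q) (cong (_+ p) x+q≡k)
      lo≤x : lo ≤ x
      lo≤x = m+n≤o⇒m≤o∸n lo lo+q≤k
      x<k : x < k
      x<k = ∸-monoʳ-< 1≤q q≤k

  periodicOn-after-mismatch : ∀ (S : List A) {p q lo hi k} → 1 ≤ q → PeriodicOn S q lo hi →
    PeriodicOn S p (suc k) hi → lo ≤ k → Mismatch S p k → hi ≤ k + q + p
  periodicOn-after-mismatch S {p} {q} {lo} {hi} {k} 1≤q per-q per-p lo≤k mismatch =
    ≮⇒≥ λ k+q+p<hi → mismatch (agree k+q+p<hi)
    where
    agree : k + q + p < hi → S ‼ k ≡ S ‼ (k + p)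
    agree k+q+p<hi = begin
      S ‼ k              ≡⟨ per-q k lo≤k (≤-<-trans (m≤m+n (k + q) p) k+q+p<hi) ⟩
      S ‼ (k + q)        ≡⟨ per-p (k + q) (subst (_≤ k + q) (+-comm k 1) (+-monoʳ-≤ k 1≤q)) k+q+p<hi ⟩
      S ‼ (k + q + p)    ≡⟨ cong (S ‼_) (+-right-comm k q p) ⟩
      S ‼ (k + p + q)    ≡⟨ sym (per-q (k + p) (≤-trans lo≤k (m≤m+n k p))
                                 (subst (_< hi) (+-right-comm k q p) k+q+p<hi)) ⟩
      S ‼ (k + p)        ∎
      where open ≡-Reasoning

  -- Profiles of a square

  -- For a square Y = T[c .. d] of the pyramid of a run pair (T[a .. b] , T[a' .. b']) with period p,
  -- L = b + 1 − c and α = a' − c are the positions in Y where the first run ends and the second starts.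
  record Profile (Y : List A) (q p L α : ℕ) : Set where
    field
      1≤p : 1 ≤ p
      4p≤q : 4 * p ≤ q
      q≤L+L : q ≤ L + L
      p≤L : p ≤ L
      prefix-periodic : PeriodicOn Y p 0 L
      prefix-mismatch : Mismatch Y p (L ∸ p)
      prefix-minimal : ∀ r M → 1 ≤ r → r ≤ p → p + p ≤ M → M ≤ L → PeriodicOn Y r 0 M → p ≤ r
      1≤α : 1 ≤ α
      α+p≤∣Y∣ : α + p ≤ length Y
      suffix-periodic : PeriodicOn Y p α (length Y)
      suffix-mismatch : Mismatch Y p (α ∸ 1)

  profileType : List A → ℕ → ℕ → ℕ → ℕ × List A × List A
  profileType Y p L α = (L ∸ α , slice Y (L ∸ p) L , slice Y α (α + p))

  TypeProfile : List A → ℕ → ℕ × List A × List A → Set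
  TypeProfile Y q t = ∃₂ λ p L → ∃ λ α → Profile Y q p L α × t ≡ profileType Y p L α

  module _ {Y : List A} {q : ℕ} where
    open Profile

    profile-period≤ : ∀ {p₁ L₁ α₁ p₂ L₂ α₂} → Profile Y q p₁ L₁ α₁ → Profile Y q p₂ L₂ α₂ →
      p₁ ≤ p₂ → p₂ ≤ p₁
    profile-period≤ {p₁} {L₁} {_} {p₂} {L₂} P₁ P₂ p₁≤p₂ =
      prefix-minimal P₂ p₁ (L₁ ⊓ L₂) (1≤p P₁) p₁≤p₂ (⊓-glb (2p₂≤ P₁) (2p₂≤ P₂)) (m⊓n≤n L₁ L₂)
        (periodicOn-mono Y ≤-refl (m⊓n≤m L₁ L₂) (prefix-periodic P₁))
      where
      2p₂≤ : ∀ {p L α} → Profile Y q p L α → p₂ + p₂ ≤ L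
      2p₂≤ {L = L} P = 4*n≤m+m⇒n+n≤m p₂ L (≤-trans (4p≤q P₂) (q≤L+L P))

    profile-end≤ : ∀ {p L₁ α₁ L₂ α₂} → Profile Y q p L₁ α₁ → Profile Y q p L₂ α₂ → L₂ ≤ L₁
    profile-end≤ {p} {L₁} P₁ P₂ = ≮⇒≥ λ L₁<L₂ →
      prefix-mismatch P₁
        (prefix-periodic P₂ (L₁ ∸ p) z≤n (subst (_< _) (sym (m∸n+n≡m (p≤L P₁))) L₁<L₂))

    profile-start≤ : ∀ {p L₁ α₁ L₂ α₂} → Profile Y q p L₁ α₁ → Profile Y q p L₂ α₂ → α₂ ≤ α₁
    profile-start≤ {p} {_} {α₁} {_} {α₂} P₁ P₂ = ≮⇒≥ λ α₁<α₂ →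
      suffix-mismatch P₂ (suffix-periodic P₁ (α₂ ∸ 1)
        (m+n≤o⇒m≤o∸n α₁ (subst (_≤ α₂) (+-comm 1 α₁) α₁<α₂))
        (<-≤-trans (+-monoˡ-< p (∸-monoʳ-< (s≤s z≤n) (1≤α P₂))) (α+p≤∣Y∣ P₂)))

    profile-period-unique : ∀ {p₁ L₁ α₁ p₂ L₂ α₂} → Profile Y q p₁ L₁ α₁ → Profile Y q p₂ L₂ α₂ →
      p₁ ≡ p₂
    profile-period-unique {p₁} {p₂ = p₂} P₁ P₂ with ≤-total p₁ p₂
    ... | inj₁ p₁≤p₂ = ≤-antisym p₁≤p₂ (profile-period≤ P₁ P₂ p₁≤p₂)
    ... | inj₂ p₂≤p₁ = ≤-antisym (profile-period≤ P₂ P₁ p₂≤p₁) p₂≤p₁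

    typeProfile-unique : ∀ {t₁ t₂} → TypeProfile Y q t₁ → TypeProfile Y q t₂ → t₁ ≡ t₂
    typeProfile-unique (p , L₁ , α₁ , P₁ , t₁≡) (p₂ , L₂ , α₂ , P₂ , t₂≡)
      with refl ← profile-period-unique P₁ P₂ = begin
      _                        ≡⟨ t₁≡ ⟩
      profileType Y p L₁ α₁    ≡⟨ cong₂ (profileType Y p) L₁≡L₂ α₁≡α₂ ⟩
      profileType Y p L₂ α₂    ≡⟨ sym t₂≡ ⟩
      _                        ∎
      where
      open ≡-Reasoning
      L₁≡L₂ : L₁ ≡ L₂
      L₁≡L₂ = ≤-antisym (profile-end≤ P₂ P₁) (profile-end≤ P₁ P₂)
      α₁≡α₂ : α₁ ≡ α₂
      α₁≡α₂ = ≤-antisym (profile-start≤ P₂ P₁) (profile-start≤ P₁ P₂)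

  -- Run pairs and their pyramids

  record RunPairGeometry (T : List A) (a b a' b' p : ℕ) : Set where
    field
      a<a' : a < a'
      a'≤1+b : a' ≤ suc b
      b<b' : b < b'
      b'<∣T∣ : b' < length T
      1≤p : 1 ≤ p
      2p≤∣F∣ : a + (p + p) ≤ suc b
      2p≤∣F'∣ : a' + (p + p) ≤ suc b'
      periodic : PeriodicOn T p a (suc b)
      periodic' : PeriodicOn T p a' (suc b')
      minimal : ∀ r → 1 ≤ r → r ≤ p → PeriodicOn T r a (suc b) → p ≤ r
      right-mismatch : Mismatch T p (suc b ∸ p)
      left-mismatch' : Mismatch T p (a' ∸ 1)

  2r≤∣str∣⇒a+2r≤1+b : ∀ (T : List A) {a b r} → a ≤ b → b < length T →
    2 * r ≤ length (str T (a , b)) → a + (r + r) ≤ suc b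
  2r≤∣str∣⇒a+2r≤1+b T {a} {b} {r} a≤b b<∣T∣ 2r≤∣F∣ = begin
    a + (r + r)         ≡⟨ cong (λ n → a + (r + n)) (sym (+-identityʳ r)) ⟩
    a + 2 * r           ≤⟨ +-monoʳ-≤ a (≤-trans 2r≤∣F∣ (≤-reflexive (length-slice T a (suc b) b<∣T∣))) ⟩
    a + (suc b ∸ a)     ≡⟨ m+[n∸m]≡n (m≤n⇒m≤1+n a≤b) ⟩
    suc b               ∎
    where open ≤-Reasoning

  runPairGeometry : ∀ {_≺_ : Rel A 0ℓ} {T a b a' b' p} →
    RunPair _≺_ T (a , b) (a' , b') p → RunPairGeometry T a b a' b' p
  runPairGeometry {T = T} {a} {b} {a'} {b'} {p}
    ( ((a≤b , b<∣T∣) , (r , perR , 2r≤∣F∣ , _ , right-maximal))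
    , ((a'≤b' , b'<∣T∣) , (r' , perR' , 2r'≤∣F'∣ , left-maximal' , _))
    , perF , perF' , _ , (i , _ , i≤1+b , a'≤i , _) , a<a')
    = record
      { a<a' = a<a' ; a'≤1+b = a'≤1+b ; b<b' = b<b' ; b'<∣T∣ = b'<∣T∣ ; 1≤p = 1≤p
      ; 2p≤∣F∣ = 2p≤∣F∣ ; 2p≤∣F'∣ = 2p≤∣F'∣ ; periodic = periodic ; periodic' = periodic'
      ; minimal = minimal ; right-mismatch = right-mismatch ; left-mismatch' = left-mismatch' }
    where
    r≡p : r ≡ p
    r≡p = per-unique (str T (a , b)) perR perF
    r'≡p : r' ≡ p
    r'≡p = per-unique (str T (a' , b')) perR' perF'
    1≤p : 1 ≤ p
    1≤p = proj₁ (proj₁ perF)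
    a'≤1+b : a' ≤ suc b
    a'≤1+b = ≤-trans a'≤i i≤1+b
    2p≤∣F∣ : a + (p + p) ≤ suc b
    2p≤∣F∣ = subst (λ n → a + (n + n) ≤ suc b) r≡p
      (2r≤∣str∣⇒a+2r≤1+b T {r = r} a≤b b<∣T∣ 2r≤∣F∣)
    2p≤∣F'∣ : a' + (p + p) ≤ suc b'
    2p≤∣F'∣ = subst (λ n → a' + (n + n) ≤ suc b') r'≡p
      (2r≤∣str∣⇒a+2r≤1+b T {r = r'} a'≤b' b'<∣T∣ 2r'≤∣F'∣)
    periodic : PeriodicOn T p a (suc b)
    periodic = period-slice⇒periodicOn T (m≤n⇒m≤1+n a≤b) b<∣T∣ (proj₁ perF)
    periodic' : PeriodicOn T p a' (suc b')
    periodic' = period-slice⇒periodicOn T (m≤n⇒m≤1+n a'≤b') b'<∣T∣ (proj₁ perF')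
    minimal : ∀ r → 1 ≤ r → r ≤ p → PeriodicOn T r a (suc b) → p ≤ r
    minimal r 1≤r r≤p per = proj₂ perF r
      (periodicOn⇒period-slice T (m≤n⇒m≤1+n a≤b) b<∣T∣ 1≤r r≤∣F∣ per)
      where
      r≤∣F∣ : r ≤ suc b ∸ a
      r≤∣F∣ = ≤-trans r≤p (m+[n+n]≤o⇒n≤o∸m a 2p≤∣F∣)
    left-mismatch' : Mismatch T p (a' ∸ 1)
    left-mismatch' = [ (λ a'≡0 → ⊥-elim (<⇒≢ (≤-<-trans z≤n a<a') (sym a'≡0)))
                     , subst (λ n → Mismatch T n (a' ∸ 1)) r'≡p ]′ left-maximal'
    b<b' : b < b'
    b<b' = ≰⇒> λ b'≤b → left-mismatch' (periodic (a' ∸ 1) a≤a'∸1 (begin-strict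
      a' ∸ 1 + p     <⟨ +-monoˡ-< p (∸-monoʳ-< (s≤s z≤n) (≤-<-trans z≤n a<a')) ⟩
      a' + p         ≤⟨ +-monoʳ-≤ a' (m≤m+n p p) ⟩
      a' + (p + p)   ≤⟨ 2p≤∣F'∣ ⟩
      suc b'         ≤⟨ s≤s b'≤b ⟩
      suc b          ∎))
      where
      open ≤-Reasoning
      a≤a'∸1 : a ≤ a' ∸ 1
      a≤a'∸1 = m+n≤o⇒m≤o∸n a (subst (_≤ a') (+-comm 1 a) a<a')
    right-mismatch : Mismatch T p (suc b ∸ p)
    right-mismatch = [ (λ 1+b≡∣T∣ → ⊥-elim (<⇒≢ (≤-trans (s≤s b<b') b'<∣T∣) 1+b≡∣T∣))
                     , (λ mismatch agree → mismatch (subst (λ n → T ‼ suc b ≡ T ‼ (suc b ∸ n)) (sym r≡p)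
                           (sym (trans agree (cong (T ‼_) (m∸n+n≡m p≤1+b)))))) ]′ right-maximal
      where
      p≤1+b : p ≤ suc b
      p≤1+b = ≤-trans (m+[n+n]≤o⇒n≤o∸m a 2p≤∣F∣) (m∸n≤m (suc b) a)

  runPair-type : ∀ {T : List A} {a b a' b' p} → RunPairGeometry T a b a' b' p →
    type T (a , b) (a' , b') p ≡ (suc b ∸ a' , slice T (suc b ∸ p) (suc b) , slice T a' (a' + p))
  runPair-type {T} {a} {b} {a'} {b'} {p} G = cong₂ _,_ common-length (cong₂ _,_ last-period first-period')
    where
    open RunPairGeometry G
    common-length : suc (b ⊓ b') ∸ (a ⊔ a') ≡ suc b ∸ a'
    common-length = cong₂ (λ m n → suc m ∸ n) (m≤n⇒m⊓n≡m (<⇒≤ b<b')) (m≤n⇒m⊔n≡n (<⇒≤ a<a'))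
    p≤∣F∣ : p ≤ suc b ∸ a
    p≤∣F∣ = m+[n+n]≤o⇒n≤o∸m a 2p≤∣F∣
    last-period : drop (length (str T (a , b)) ∸ p) (str T (a , b)) ≡ slice T (suc b ∸ p) (suc b)
    last-period = begin
      drop (length (slice T a (suc b)) ∸ p) (slice T a (suc b))
        ≡⟨ cong (λ n → drop (n ∸ p) (slice T a (suc b))) (length-slice T a (suc b) (<-trans b<b' b'<∣T∣)) ⟩
      drop (suc b ∸ a ∸ p) (slice T a (suc b))
        ≡⟨ drop-slice T a (suc b) (suc b ∸ a ∸ p) ⟩
      slice T (a + (suc b ∸ a ∸ p)) (suc b)
        ≡⟨ cong (λ i → slice T i (suc b)) (sym (+-∸-assoc a p≤∣F∣)) ⟩
      slice T (a + (suc b ∸ a) ∸ p) (suc b)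
        ≡⟨ cong (λ i → slice T (i ∸ p) (suc b)) (m+[n∸m]≡n (≤-trans (m≤m+n a (p + p)) 2p≤∣F∣)) ⟩
      slice T (suc b ∸ p) (suc b)
        ∎
      where open ≡-Reasoning
    first-period' : take p (str T (a' , b')) ≡ slice T a' (a' + p)
    first-period' = take-slice T (≤-trans (+-monoʳ-≤ a' (m≤m+n p p)) 2p≤∣F'∣)

  module SquareInPyramid {T X : List A} {a b a' b' p q c d : ℕ}
    (G : RunPairGeometry T a b a' b' p) (perY : Per (X ++ X) q) (4p≤q : 4 * p ≤ q)
    (a≤c : a ≤ c) (c≤d : c ≤ d) (d≤b' : d ≤ b') (occurrence : str T (c , d) ≡ X ++ X) where
    open RunPairGeometry G

    Y : List A
    Y = X ++ X

    n : ℕ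
    n = length Y

    c+n≡1+d : c + n ≡ suc d
    c+n≡1+d = trans (cong (c +_) ∣Y∣≡) (m+[n∸m]≡n (m≤n⇒m≤1+n c≤d))
      where
      ∣Y∣≡ : n ≡ suc d ∸ c
      ∣Y∣≡ = trans (cong length (sym occurrence)) (length-slice T c (suc d) (≤-<-trans d≤b' b'<∣T∣))

    c+[≤n]≤1+d : ∀ {k} → k ≤ n → c + k ≤ suc d
    c+[≤n]≤1+d k≤n = ≤-trans (+-monoʳ-≤ c k≤n) (≤-reflexive c+n≡1+d)

    c+n≤1+b' : c + n ≤ suc b'
    c+n≤1+b' = ≤-trans (≤-reflexive c+n≡1+d) (s≤s d≤b')

    1≤q : 1 ≤ q
    1≤q = proj₁ (proj₁ perY)

    p+p≤q : p + p ≤ q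
    p+p≤q = ≤-trans (+-monoʳ-≤ p (m≤m+n p _)) 4p≤q

    q+q≤n : q + q ≤ n
    q+q≤n = subst (q + q ≤_) (sym (length-++ X)) (+-mono-≤ (per-square≤ X perY) (per-square≤ X perY))

    Y-periodicOn : ∀ {r i j} → j ≤ n → PeriodicOn T r (c + i) (c + j) → PeriodicOn Y r i j
    Y-periodicOn {r} {i} {j} j≤n per = subst (λ S → PeriodicOn S r i j) occurrence
      (periodicOn-slice⁺ T (c+[≤n]≤1+d j≤n) per)

    T-periodicOn : ∀ {r M} → M ≤ n → PeriodicOn Y r 0 M → PeriodicOn T r c (c + M)
    T-periodicOn {r} {M} M≤n per = periodicOn-slice⁻ T (c+[≤n]≤1+d M≤n)
      (subst (λ S → PeriodicOn S r 0 M) (sym occurrence) per)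

    Y-mismatch : ∀ {k} → k + p < n → Mismatch T p (c + k) → Mismatch Y p k
    Y-mismatch {k} k+p<n mismatch agree = mismatch (begin
      T ‼ (c + k)          ≡⟨ sym (Y‼ (≤-<-trans (m≤m+n k p) k+p<n)) ⟩
      Y ‼ k                ≡⟨ agree ⟩
      Y ‼ (k + p)          ≡⟨ Y‼ k+p<n ⟩
      T ‼ (c + (k + p))    ≡⟨ cong (T ‼_) (sym (+-assoc c k p)) ⟩
      T ‼ (c + k + p)      ∎)
      where
      open ≡-Reasoning
      Y‼ : ∀ {i} → i < n → Y ‼ i ≡ T ‼ (c + i)
      Y‼ {i} i<n = subst (λ S → S ‼ i ≡ T ‼ (c + i)) occurrence
        (‼-slice T c (suc d) (<-≤-trans (+-monoʳ-< c i<n) (≤-reflexive c+n≡1+d)))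

    not-p-periodic : ¬ PeriodicOn T p c (c + n)
    not-p-periodic per = <⇒≱ (≤-trans (+-monoˡ-≤ p 1≤p) p+p≤q) (proj₂ perY p period-p)
      where
      period-p : Period Y p
      period-p = periodicOn⇒period Y 1≤p
        (≤-trans (≤-trans (m≤m+n p p) p+p≤q) (≤-trans (m≤m+n q q) q+q≤n))
        (Y-periodicOn ≤-refl (periodicOn-mono T (m≤m+n c 0) ≤-refl per))

    c<a' : c < a'
    c<a' = ≰⇒> λ a'≤c → not-p-periodic (periodicOn-mono T a'≤c c+n≤1+b' periodic')

    b<d : b < d
    b<d = ≰⇒> λ d≤b →
      not-p-periodic (periodicOn-mono T a≤c (≤-trans (≤-reflexive c+n≡1+d) (s≤s d≤b)) periodic)

    L α : ℕ
    L = suc b ∸ c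
    α = a' ∸ c

    c+L≡1+b : c + L ≡ suc b
    c+L≡1+b = m+[n∸m]≡n (≤-trans (<⇒≤ c<a') a'≤1+b)

    c+α≡a' : c + α ≡ a'
    c+α≡a' = m+[n∸m]≡n (<⇒≤ c<a')

    1≤α : 1 ≤ α
    1≤α = m<n⇒0<n∸m c<a'

    α≤L : α ≤ L
    α≤L = ∸-monoˡ-≤ c a'≤1+b

    L<n : L < n
    L<n = +-cancelˡ-< c L n (subst₂ _<_ (sym c+L≡1+b) (sym c+n≡1+d) (s≤s b<d))

    q-periodic : PeriodicOn T q c (c + n)
    q-periodic = T-periodicOn ≤-refl (period⇒periodicOn Y (proj₁ perY))

    q<α+p : q < α + p
    q<α+p = +-cancelʳ-< q q (α + p) (+-cancelˡ-< c (q + q) (α + p + q) (begin-strict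
      c + (q + q)        ≤⟨ +-monoʳ-≤ c q+q≤n ⟩
      c + n              ≤⟨ periodicOn-after-mismatch T 1≤q q-periodic p-periodic' c≤a'∸1 left-mismatch' ⟩
      a' ∸ 1 + q + p     <⟨ +-monoˡ-< p (+-monoˡ-< q (∸-monoʳ-< (s≤s z≤n) 1≤a')) ⟩
      a' + q + p         ≡⟨ cong (λ x → x + q + p) (sym c+α≡a') ⟩
      c + α + q + p      ≡⟨ +-right-comm (c + α) q p ⟩
      c + α + p + q      ≡⟨ cong (_+ q) (+-assoc c α p) ⟩
      c + (α + p) + q    ≡⟨ +-assoc c (α + p) q ⟩
      c + (α + p + q)    ∎))
      where
      open ≤-Reasoning
      1≤a' : 1 ≤ a'
      1≤a' = ≤-<-trans z≤n a<a'
      c≤a'∸1 : c ≤ a' ∸ 1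
      c≤a'∸1 = m+n≤o⇒m≤o∸n c (subst (_≤ a') (+-comm 1 c) c<a')
      p-periodic' : PeriodicOn T p (suc (a' ∸ 1)) (c + n)
      p-periodic' = periodicOn-mono T (≤-reflexive (sym (m+[n∸m]≡n 1≤a'))) c+n≤1+b' periodic'

    L<p+q : L < p + q
    L<p+q = +-cancelˡ-< c L (p + q) (begin-strict
      c + L              ≡⟨ c+L≡1+b ⟩
      suc b              ≡⟨ sym (m∸n+n≡m p≤1+b) ⟩
      suc b ∸ p + p      <⟨ +-monoˡ-< p
                              (periodicOn-before-mismatch T 1≤q q-periodic p-periodic 1+b<c+n right-mismatch) ⟩
      c + q + p          ≡⟨ solve (c ∷ q ∷ p ∷ []) ⟩
      c + (p + q)        ∎)
      where
      open ≤-Reasoning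
      p≤1+b : p ≤ suc b
      p≤1+b = ≤-trans (m+[n+n]≤o⇒n≤o∸m a 2p≤∣F∣) (m∸n≤m (suc b) a)
      p-periodic : PeriodicOn T p c (suc b ∸ p + p)
      p-periodic = periodicOn-mono T a≤c (≤-reflexive (m∸n+n≡m p≤1+b)) periodic
      1+b<c+n : suc b ∸ p + p < c + n
      1+b<c+n = subst₂ _<_ (sym (m∸n+n≡m p≤1+b)) (sym c+n≡1+d) (s≤s b<d)

    p≤L : p ≤ L
    p≤L = ≮⇒≥ λ L<p → <⇒≱ (begin-strict
      q        <⟨ q<α+p ⟩
      α + p    ≤⟨ +-monoˡ-≤ p (≤-trans α≤L (<⇒≤ L<p)) ⟩
      p + p    ∎) p+p≤q
      where open ≤-Reasoning

    α+p≤n : α + p ≤ n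
    α+p≤n = begin
      α + p          ≤⟨ +-monoˡ-≤ p (≤-trans α≤L (<⇒≤ L<p+q)) ⟩
      p + q + p      ≡⟨ solve (p ∷ q ∷ []) ⟩
      q + (p + p)    ≤⟨ +-monoʳ-≤ q p+p≤q ⟩
      q + q          ≤⟨ q+q≤n ⟩
      n              ∎
      where open ≤-Reasoning

    profile : Profile Y q p L α
    profile = record
      { 1≤p = 1≤p
      ; 4p≤q = 4p≤q
      ; q≤L+L = <⇒≤ (<-≤-trans q<α+p (+-mono-≤ α≤L p≤L))
      ; p≤L = p≤L
      ; prefix-periodic = Y-periodicOn (<⇒≤ L<n)
          (periodicOn-mono T (≤-trans a≤c (m≤m+n c 0)) (≤-reflexive c+L≡1+b) periodic)
      ; prefix-mismatch = Y-mismatch (subst (_< n) (sym (m∸n+n≡m p≤L)) L<n)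
          (subst (Mismatch T p) (trans (cong (_∸ p) (sym c+L≡1+b)) (+-∸-assoc c p≤L)) right-mismatch)
      ; prefix-minimal = prefix-minimal
      ; 1≤α = 1≤α
      ; α+p≤∣Y∣ = α+p≤n
      ; suffix-periodic = Y-periodicOn ≤-refl
          (periodicOn-mono T (≤-reflexive (sym c+α≡a')) c+n≤1+b' periodic')
      ; suffix-mismatch = Y-mismatch (<-≤-trans (+-monoˡ-< p (∸-monoʳ-< (s≤s z≤n) 1≤α)) α+p≤n)
          (subst (Mismatch T p) (trans (cong (_∸ 1) (sym c+α≡a')) (+-∸-assoc c 1≤α)) left-mismatch')
      }
      where
      prefix-minimal : ∀ r M → 1 ≤ r → r ≤ p → p + p ≤ M → M ≤ L → PeriodicOn Y r 0 M → p ≤ r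
      prefix-minimal r M 1≤r r≤p 2p≤M M≤L per = minimal r 1≤r r≤p
        (periodicOn-extend T 1≤p periodic a≤c (≤-trans (+-monoʳ-≤ c M≤L) (≤-reflexive c+L≡1+b))
          (≤-trans (+-monoˡ-≤ p r≤p) 2p≤M) (T-periodicOn (≤-trans M≤L (<⇒≤ L<n)) per))

    type≡profileType : type T (a , b) (a' , b') p ≡ profileType Y p L α
    type≡profileType =
      trans (runPair-type G) (cong₂ _,_ common-length (cong₂ _,_ last-period first-period'))
      where
      open ≡-Reasoning
      common-length : suc b ∸ a' ≡ L ∸ α
      common-length = trans (cong₂ _∸_ (sym c+L≡1+b) (sym c+α≡a')) ([m+n]∸[m+o]≡n∸o c L α)
      last-period : slice T (suc b ∸ p) (suc b) ≡ slice Y (L ∸ p) L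
      last-period = begin
        slice T (suc b ∸ p) (suc b)
          ≡⟨ cong₂ (slice T) (trans (cong (_∸ p) (sym c+L≡1+b)) (+-∸-assoc c p≤L)) (sym c+L≡1+b) ⟩
        slice T (c + (L ∸ p)) (c + L)
          ≡⟨ sym (slice-slice T c (suc d) (m∸n≤m L p) (c+[≤n]≤1+d (<⇒≤ L<n))) ⟩
        slice (slice T c (suc d)) (L ∸ p) L
          ≡⟨ cong (λ S → slice S (L ∸ p) L) occurrence ⟩
        slice Y (L ∸ p) L
          ∎
      first-period' : slice T a' (a' + p) ≡ slice Y α (α + p)
      first-period' = begin
        slice T a' (a' + p)
          ≡⟨ cong₂ (slice T) (sym c+α≡a') (trans (cong (_+ p) (sym c+α≡a')) (+-assoc c α p)) ⟩
        slice T (c + α) (c + (α + p))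
          ≡⟨ sym (slice-slice T c (suc d) (m≤m+n α p) (c+[≤n]≤1+d α+p≤n)) ⟩
        slice (slice T c (suc d)) α (α + p)
          ≡⟨ cong (λ S → slice S α (α + p)) occurrence ⟩
        slice Y α (α + p)
          ∎

    typeProfile : TypeProfile Y q (type T (a , b) (a' , b') p)
    typeProfile = p , L , α , profile , type≡profileType

  pyramid-typeProfile : ∀ {_≺_ : Rel A 0ℓ} {T F F' p X} → RunPair _≺_ T F F' p → PyrSq T F F' p X →
    ∃ λ q → Per (X ++ X) q × TypeProfile (X ++ X) q (type T F F' p)
  pyramid-typeProfile {T = T} {a , b} {a' , b'} {p} {X} runPair
    ( (r₁ , r₂) , (_ , _ , q' , _ , 4p≤q' , _ , perV , _)
    , c , d , v₁≤c , c≤d , d≤v₂ , occurrence , q , perV' , perY )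
    = q , perY , SquareInPyramid.typeProfile {X = X} G perY 4p≤q a≤c c≤d d≤b' occurrence
    where
    G : RunPairGeometry T a b a' b' p
    G = runPairGeometry runPair
    open RunPairGeometry G
    4p≤q : 4 * p ≤ q
    4p≤q = subst (4 * p ≤_) (per-unique (str T ((r₁ , r₂) ∩F ((a , b) ∪F (a' , b')))) perV perV')
      4p≤q'
    a≤c : a ≤ c
    a≤c = ≤-trans (≤-reflexive (sym (m≤n⇒m⊓n≡m (<⇒≤ a<a')))) (≤-trans (m≤n⊔m r₁ (a ⊓ a')) v₁≤c)
    d≤b' : d ≤ b'
    d≤b' = ≤-trans d≤v₂ (≤-trans (m⊓n≤n r₂ (b ⊔ b')) (≤-reflexive (m≤n⇒m⊔n≡n (<⇒≤ b<b'))))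

  squareProfiles-agree : ∀ {X : List A} {t₁ t₂} →
    (∃ λ q → Per (X ++ X) q × TypeProfile (X ++ X) q t₁) →
    (∃ λ q → Per (X ++ X) q × TypeProfile (X ++ X) q t₂) → t₁ ≡ t₂
  squareProfiles-agree {X} (q₁ , perY₁ , P₁) (q₂ , perY₂ , P₂) =
    typeProfile-unique P₁ (subst (λ q → TypeProfile (X ++ X) q _) (per-unique (X ++ X) perY₂ perY₁) P₂)

lemma42 : {A : Set} (_<_ : Rel A 0ℓ) → IsStrictTotalOrder _≡_ _<_ →
    (T : List A) (F₁ F₁' F₂ F₂' : Frag) (p₁ p₂ : ℕ) →
    RunPair _<_ T F₁ F₁' p₁ → RunPair _<_ T F₂ F₂' p₂ →
    type T F₁ F₁' p₁ ≢ type T F₂ F₂' p₂ →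
    (X : List A) → ¬ (PyrSq T F₁ F₁' p₁ X × PyrSq T F₂ F₂' p₂ X)
lemma42 _ _ T F₁ F₁' F₂ F₂' p₁ p₂ runPair₁ runPair₂ types-differ X (square₁ , square₂) =
  types-differ (squareProfiles-agree {X = X}
    (pyramid-typeProfile {X = X} runPair₁ square₁) (pyramid-typeProfile {X = X} runPair₂ square₂))
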